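{- Let $\mathcal{H}$ be a pre-Hilbert category and $f:X\to Y$ a morphism. Define $f^\perp=\perp_Y\circ\exists_f^{\mathrm{op}}:\mathrm{ClSub}(X)^{\mathrm{op}}\to\mathrm{ClSub}(Y)$ and similarly $(f^\dagger)^\perp=\perp_X\circ\exists_{f^\dagger}^{\mathrm{op}}:\mathrm{ClSub}(Y)^{\mathrm{op}}\to\mathrm{ClSub}(X)$. Then $(f^\perp)^{\mathrm{op}}\dashv(f^\dagger)^\perp$; explicitly, for all $M\in\mathrm{ClSub}(X)$ and $N\in\mathrm{ClSub}(Y)$, $N\le(\exists_f M)^\perp$ if and only if $M\le(\exists_{f^\dagger}N)^\perp$.
   Context: A $\dagger$-category is a category $\mathcal{H}$ with a functor $\dagger:\mathcal{H}^{\mathrm{op}}\to\mathcal{H}$ that is the identity on objects with $f^{\dagger\dagger}=f$. A morphism $m$ is a $\dagger$-mono if $m^\dagger m=\mathrm{id}$, a $\dagger$-epi if $mm^\dagger=\mathrm{id}$. A pre-Hilbert category is a $\dagger$-category such that: it has finite $\dagger$-biproducts (finite biproducts, including a zero object, with $\pi^\dagger=\kappa$); it has finite $\dagger$-equalisers (equalisers that are $\dagger$-monos); every $\dagger$-mono is a kernel of some morphism; and it is symmetric $\dagger$-monoidal ($(f\otimes g)^\dagger=f^\dagger\otimes g^\dagger$, coherence isomorphisms $\dagger$-isos). Kernels are chosen to be $\dagger$-monos. A subobject of $X$ is an equivalence class of monos into $X$ (modulo isomorphism of domains commuting with the monos), ordered by factorisation; $\mathrm{ClSub}(X)$ is the poset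 (viewed as a category) of subobjects representable by a $\dagger$-mono. Every morphism $h$ factors as $h=me$ with $e$ epi and $m$ a $\dagger$-mono, unique up to $\dagger$-iso; $\mathrm{Im}(h)$ is the subobject represented by $m$. For $f:X\to Y$, $\exists_f:\mathrm{ClSub}(X)\to\mathrm{ClSub}(Y)$ is $\exists_f(M)=\mathrm{Im}(f\circ m)$ for $m$ a $\dagger$-mono representing $M$. $\perp_X:\mathrm{ClSub}(X)^{\mathrm{op}}\to\mathrm{ClSub}(X)$ sends $m$ to $m^\perp=\ker(m^\dagger)$. -}

module Defs where

open import Level using (Level; _⊔_; suc)
open import Data.Product using (Σ; ∃; _×_; _,_)
open import Relation.Binary using (Rel; IsEquivalence)

record Category (o ℓ e : Level) : Set (suc (o ⊔ ℓ ⊔ e)) where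
  infix  4 _≈_
  infixr 9 _∘_
  field
    Obj  : Set o
    Hom  : Obj → Obj → Set ℓ
    _≈_  : ∀ {A B} → Rel (Hom A B) e
    ≈-equiv : ∀ {A B} → IsEquivalence (_≈_ {A} {B})
    id   : ∀ {A} → Hom A A
    _∘_  : ∀ {A B C} → Hom B C → Hom A B → Hom A C
    ∘-resp-≈ : ∀ {A B C} {f f′ : Hom B C} {g g′ : Hom A B} →
               f ≈ f′ → g ≈ g′ → f ∘ g ≈ f′ ∘ g′
    assoc : ∀ {A B C D} {f : Hom A B} {g : Hom B C} {h : Hom C D} →
            (h ∘ g) ∘ f ≈ h ∘ (g ∘ f)
    identityˡ : ∀ {A B} {f : Hom A B} → id ∘ f ≈ f
    identityʳ : ∀ {A B} {f : Hom A B} → f ∘ id ≈ f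

record DaggerCategory (o ℓ e : Level) : Set (suc (o ⊔ ℓ ⊔ e)) where
  infix 10 _†
  field
    category : Category o ℓ e
  open Category category public
  field
    _†      : ∀ {A B} → Hom A B → Hom B A
    †-resp-≈ : ∀ {A B} {f g : Hom A B} → f ≈ g → f † ≈ g †
    †-identity : ∀ {A} → (id {A}) † ≈ id
    †-homomorphism : ∀ {A B C} {f : Hom A B} {g : Hom B C} →
                     (g ∘ f) † ≈ f † ∘ g †
    †-involutive : ∀ {A B} {f : Hom A B} → f † † ≈ f

module Notions {o ℓ e} (𝓒 : DaggerCategory o ℓ e) where
  open DaggerCategory 𝓒

  IsMono : ∀ {A B} → Hom A B → Set (o ⊔ ℓ ⊔ e)
  IsMono {A} m = ∀ {C} (g h : Hom C A) → m ∘ g ≈ m ∘ h → g ≈ h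

  IsEpi : ∀ {A B} → Hom A B → Set (o ⊔ ℓ ⊔ e)
  IsEpi {B = B} p = ∀ {C} (g h : Hom B C) → g ∘ p ≈ h ∘ p → g ≈ h

  IsDaggerMono : ∀ {A B} → Hom A B → Set e
  IsDaggerMono m = m † ∘ m ≈ id

  IsDaggerEpi : ∀ {A B} → Hom A B → Set e
  IsDaggerEpi m = m ∘ m † ≈ id

  IsDaggerIso : ∀ {A B} → Hom A B → Set e
  IsDaggerIso m = IsDaggerMono m × IsDaggerEpi m

  IsInitial : Obj → Set (o ⊔ ℓ ⊔ e)
  IsInitial Z = ∀ A → Σ (Hom Z A) λ u → ∀ (v : Hom Z A) → v ≈ u

  IsTerminal : Obj → Set (o ⊔ ℓ ⊔ e)
  IsTerminal Z = ∀ A → Σ (Hom A Z) λ u → ∀ (v : Hom A Z) → v ≈ u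

  IsEqualiser : ∀ {E A B} → Hom E A → Hom A B → Hom A B → Set (o ⊔ ℓ ⊔ e)
  IsEqualiser {E} {A} eq f g =
    (f ∘ eq ≈ g ∘ eq) ×
    (∀ {C} (h : Hom C A) → f ∘ h ≈ g ∘ h →
       Σ (Hom C E) λ u → (eq ∘ u ≈ h) × (∀ (v : Hom C E) → eq ∘ v ≈ h → v ≈ u))

  IsProduct : ∀ {P A B} → Hom P A → Hom P B → Set (o ⊔ ℓ ⊔ e)
  IsProduct {P} {A} {B} p₁ p₂ =
    ∀ {C} (f : Hom C A) (g : Hom C B) →
      Σ (Hom C P) λ u → (p₁ ∘ u ≈ f) × (p₂ ∘ u ≈ g) ×
        (∀ (v : Hom C P) → p₁ ∘ v ≈ f → p₂ ∘ v ≈ g → v ≈ u)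

  IsCoproduct : ∀ {P A B} → Hom A P → Hom B P → Set (o ⊔ ℓ ⊔ e)
  IsCoproduct {P} {A} {B} i₁ i₂ =
    ∀ {C} (f : Hom A C) (g : Hom B C) →
      Σ (Hom P C) λ u → (u ∘ i₁ ≈ f) × (u ∘ i₂ ≈ g) ×
        (∀ (v : Hom P C) → v ∘ i₁ ≈ f → v ∘ i₂ ≈ g → v ≈ u)

  infix 4 _≤ₛ_
  _≤ₛ_ : ∀ {A B X} → Hom A X → Hom B X → Set (ℓ ⊔ e)
  _≤ₛ_ {A} {B} m n = Σ (Hom A B) λ h → m ≈ n ∘ h

  IsImageOf : ∀ {I A Y} → Hom I Y → Hom A Y → Set (o ⊔ ℓ ⊔ e)
  IsImageOf {I} {A} i h =
    IsDaggerMono i × Σ (Hom A I) λ p → IsEpi p × (h ≈ i ∘ p)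

record ZeroObject {o ℓ e} (𝓒 : DaggerCategory o ℓ e) : Set (o ⊔ ℓ ⊔ e) where
  open DaggerCategory 𝓒
  open Notions 𝓒
  field
    𝟘 : Obj
    𝟘-initial  : IsInitial 𝟘
    𝟘-terminal : IsTerminal 𝟘

module ZeroNotions {o ℓ e} {𝓒 : DaggerCategory o ℓ e} (Z : ZeroObject 𝓒) where
  open DaggerCategory 𝓒
  open Notions 𝓒
  open ZeroObject Z

  zero : ∀ {A B} → Hom A B
  zero {A} {B} = Data.Product.proj₁ (𝟘-initial B) ∘ Data.Product.proj₁ (𝟘-terminal A)
    where import Data.Product

  IsKernel : ∀ {K A B} → Hom K A → Hom A B → Set (o ⊔ ℓ ⊔ e)
  IsKernel k g = IsEqualiser k g zero

  -- k represents m^⊥ = ker(m†), kernels being chosen †-monos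
  IsPerpOf : ∀ {K I X} → Hom K X → Hom I X → Set (o ⊔ ℓ ⊔ e)
  IsPerpOf k m = IsDaggerMono k × IsKernel k (m †)

  record DaggerBiproduct (A B : Obj) : Set (o ⊔ ℓ ⊔ e) where
    field
      A⊕B : Obj
      π₁ : Hom A⊕B A
      π₂ : Hom A⊕B B
      κ₁ : Hom A A⊕B
      κ₂ : Hom B A⊕B
      isProduct   : IsProduct π₁ π₂
      isCoproduct : IsCoproduct κ₁ κ₂
      π₁κ₁ : π₁ ∘ κ₁ ≈ id
      π₂κ₂ : π₂ ∘ κ₂ ≈ id
      π₁κ₂ : π₁ ∘ κ₂ ≈ zero
      π₂κ₁ : π₂ ∘ κ₁ ≈ zero
      π₁†  : π₁ † ≈ κ₁
      π₂†  : π₂ † ≈ κ₂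

record SymmetricDaggerMonoidal {o ℓ e} (𝓒 : DaggerCategory o ℓ e)
       : Set (o ⊔ ℓ ⊔ e) where
  open DaggerCategory 𝓒
  open Notions 𝓒
  infixr 10 _⊗₀_ _⊗₁_
  field
    _⊗₀_ : Obj → Obj → Obj
    _⊗₁_ : ∀ {A B C D} → Hom A B → Hom C D → Hom (A ⊗₀ C) (B ⊗₀ D)
    ⊗-resp-≈ : ∀ {A B C D} {f f′ : Hom A B} {g g′ : Hom C D} →
               f ≈ f′ → g ≈ g′ → f ⊗₁ g ≈ f′ ⊗₁ g′
    ⊗-identity : ∀ {A B} → id {A} ⊗₁ id {B} ≈ id
    ⊗-homomorphism : ∀ {A B C D E F} {f : Hom A B} {g : Hom B C}
                       {h : Hom D E} {k : Hom E F} →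
                     (g ∘ f) ⊗₁ (k ∘ h) ≈ (g ⊗₁ k) ∘ (f ⊗₁ h)
    unit : Obj
    α : ∀ {A B C} → Hom ((A ⊗₀ B) ⊗₀ C) (A ⊗₀ (B ⊗₀ C))
    λ′ : ∀ {A} → Hom (unit ⊗₀ A) A
    ρ : ∀ {A} → Hom (A ⊗₀ unit) A
    σ : ∀ {A B} → Hom (A ⊗₀ B) (B ⊗₀ A)
    α-unitary : ∀ {A B C} → IsDaggerIso (α {A} {B} {C})
    λ-unitary : ∀ {A} → IsDaggerIso (λ′ {A})
    ρ-unitary : ∀ {A} → IsDaggerIso (ρ {A})
    σ-unitary : ∀ {A B} → IsDaggerIso (σ {A} {B})
    α-natural : ∀ {A A′ B B′ C C′} {f : Hom A A′} {g : Hom B B′} {h : Hom C C′} →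
                α ∘ ((f ⊗₁ g) ⊗₁ h) ≈ (f ⊗₁ (g ⊗₁ h)) ∘ α
    λ-natural : ∀ {A B} {f : Hom A B} → λ′ ∘ (id ⊗₁ f) ≈ f ∘ λ′
    ρ-natural : ∀ {A B} {f : Hom A B} → ρ ∘ (f ⊗₁ id) ≈ f ∘ ρ
    σ-natural : ∀ {A A′ B B′} {f : Hom A A′} {g : Hom B B′} →
                σ ∘ (f ⊗₁ g) ≈ (g ⊗₁ f) ∘ σ
    pentagon : ∀ {A B C D} →
      (id {A} ⊗₁ α {B} {C} {D}) ∘ (α {A} {B ⊗₀ C} {D} ∘ (α {A} {B} {C} ⊗₁ id {D}))
        ≈ α {A} {B} {C ⊗₀ D} ∘ α {A ⊗₀ B} {C} {D}
    triangle : ∀ {A B} →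
      (id {A} ⊗₁ λ′ {B}) ∘ α {A} {unit} {B} ≈ ρ {A} ⊗₁ id {B}
    hexagon : ∀ {A B C} →
      α {B} {C} {A} ∘ (σ {A} {B ⊗₀ C} ∘ α {A} {B} {C})
        ≈ (id {B} ⊗₁ σ {A} {C}) ∘ (α {B} {A} {C} ∘ (σ {A} {B} ⊗₁ id {C}))
    σ-involutive : ∀ {A B} → σ {B} {A} ∘ σ {A} {B} ≈ id
    ⊗-† : ∀ {A B C D} {f : Hom A B} {g : Hom C D} → (f ⊗₁ g) † ≈ (f †) ⊗₁ (g †)

record PreHilbertCategory (o ℓ e : Level) : Set (suc (o ⊔ ℓ ⊔ e)) where
  field
    daggerCategory : DaggerCategory o ℓ e
  open DaggerCategory daggerCategory public
  open Notions daggerCategory public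
  field
    zeroObject : ZeroObject daggerCategory
  open ZeroObject zeroObject public
  open ZeroNotions zeroObject public
  field
    -- finite †-biproducts (zero object + binary †-biproducts)
    biproduct : ∀ A B → DaggerBiproduct A B
    equaliser : ∀ {A B} (f g : Hom A B) →
                Σ Obj λ E → Σ (Hom E A) λ eq → IsEqualiser eq f g × IsDaggerMono eq
    daggerMono-kernel : ∀ {A B} (m : Hom A B) → IsDaggerMono m →
                        Σ Obj λ C → Σ (Hom B C) λ g → IsKernel m g
    monoidal : SymmetricDaggerMonoidal daggerCategory

module Submission where

-- Both sides say that f m and n are orthogonal, (f m)† n = 0: lying below
-- the kernel of i† means being annihilated by i†; the epi part of an image
-- factorisation can be cancelled because its dagger is mono; and
-- (f m)† n = m† (f† n) vanishes iff its dagger (f† n)† m does, as 0† = 0.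

open import Defs
open import Function.Bundles using (_⇔_; mk⇔)
open import Function.Properties.Equivalence using () renaming (trans to ⇔-trans; sym to ⇔-sym)
open import Data.Product using (_,_; proj₁; proj₂)
open import Relation.Binary using (Setoid; IsEquivalence)
import Relation.Binary.Reasoning.Setoid as SetoidReasoning

module Orthogonality {o ℓ e} (𝓒 : DaggerCategory o ℓ e) (Z : ZeroObject 𝓒) where
  open DaggerCategory 𝓒
  open Notions 𝓒
  open ZeroObject Z
  open ZeroNotions Z

  private
    module ≈ {A B : Obj} = IsEquivalence (≈-equiv {A} {B})

    hom-setoid : Obj → Obj → Setoid ℓ e
    hom-setoid A B = record { Carrier = Hom A B ; _≈_ = _≈_ ; isEquivalence = ≈-equiv }

    module Reasoning {A B : Obj} = SetoidReasoning (hom-setoid A B)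

  open Reasoning

  infix 4 _⟂_
  _⟂_ : ∀ {A B X} → Hom A X → Hom B X → Set e
  m ⟂ n = m † ∘ n ≈ zero

  zero-∘ : ∀ {A B C} (h : Hom A B) → zero {B} {C} ∘ h ≈ zero
  zero-∘ {A} {B} h = ≈.trans assoc (∘-resp-≈ ≈.refl (proj₂ (𝟘-terminal A) (proj₁ (𝟘-terminal B) ∘ h)))

  ∘-zero : ∀ {A B C} (h : Hom B C) → h ∘ zero {A} {B} ≈ zero
  ∘-zero {B = B} {C} h = ≈.trans (≈.sym assoc) (∘-resp-≈ (proj₂ (𝟘-initial C) (h ∘ proj₁ (𝟘-initial B))) ≈.refl)

  zero-† : ∀ {A B} → zero {A} {B} † ≈ zero
  zero-† {A} {B} = ≈.trans †-homomorphism
    (∘-resp-≈ (proj₂ (𝟘-initial A) _) (proj₂ (𝟘-terminal B) _))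

  †-∘-† : ∀ {A B C} (g : Hom B C) (h : Hom A C) → (g † ∘ h) † ≈ h † ∘ g
  †-∘-† g h = ≈.trans †-homomorphism (∘-resp-≈ ≈.refl †-involutive)

  ⟂-sym : ∀ {A B X} {m : Hom A X} {n : Hom B X} → m ⟂ n → n ⟂ m
  ⟂-sym {m = m} {n} m⟂n = begin
    n † ∘ m         ≈⟨ †-∘-† m n ⟨
    (m † ∘ n) †     ≈⟨ †-resp-≈ m⟂n ⟩
    zero †          ≈⟨ zero-† ⟩
    zero            ∎

  ∘-⟂⇔⟂-†∘ : ∀ {X Y A B} (f : Hom X Y) (m : Hom A X) (n : Hom B Y) →
             (f ∘ m ⟂ n) ⇔ (m ⟂ f † ∘ n)
  ∘-⟂⇔⟂-†∘ f m n = mk⇔ (≈.trans (≈.sym adjoint)) (≈.trans adjoint)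
    where
    adjoint : (f ∘ m) † ∘ n ≈ m † ∘ (f † ∘ n)
    adjoint = ≈.trans (∘-resp-≈ †-homomorphism ≈.refl) assoc

  ≤ₛ-kernel⇔annihilated : ∀ {K Y Z C} {k : Hom K Y} {g : Hom Y Z} → IsKernel k g →
                          (n : Hom C Y) → (n ≤ₛ k) ⇔ (g ∘ n ≈ zero)
  ≤ₛ-kernel⇔annihilated {k = k} {g} (gk≈0 , universal) n = mk⇔ to from
    where
    to : n ≤ₛ k → g ∘ n ≈ zero
    to (h , n≈kh) = begin
      g ∘ n           ≈⟨ ∘-resp-≈ ≈.refl n≈kh ⟩
      g ∘ (k ∘ h)     ≈⟨ assoc ⟨
      (g ∘ k) ∘ h     ≈⟨ ∘-resp-≈ gk≈0 ≈.refl ⟩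
      (zero ∘ k) ∘ h  ≈⟨ ∘-resp-≈ (zero-∘ k) ≈.refl ⟩
      zero ∘ h        ≈⟨ zero-∘ h ⟩
      zero            ∎
    from : g ∘ n ≈ zero → n ≤ₛ k
    from gn≈0 with universal n (≈.trans gn≈0 (≈.sym (zero-∘ n)))
    ... | u , ku≈n , _ = u , ≈.sym ku≈n

  ≤ₛ-perp⇔⟂ : ∀ {K I X C} {k : Hom K X} {i : Hom I X} → IsPerpOf k i →
              (n : Hom C X) → (n ≤ₛ k) ⇔ (i ⟂ n)
  ≤ₛ-perp⇔⟂ (_ , k-kernel) = ≤ₛ-kernel⇔annihilated k-kernel

  epi⇒†-mono : ∀ {A B} {p : Hom A B} → IsEpi p → IsMono (p †)
  epi⇒†-mono {p = p} p-epi g h p†g≈p†h = begin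
    g               ≈⟨ †-involutive ⟨
    g † †           ≈⟨ †-resp-≈ (p-epi (g †) (h †) g†p≈h†p) ⟩
    h † †           ≈⟨ †-involutive ⟩
    h               ∎
    where
    g†p≈h†p : g † ∘ p ≈ h † ∘ p
    g†p≈h†p = begin
      g † ∘ p       ≈⟨ †-∘-† p g ⟨
      (p † ∘ g) †   ≈⟨ †-resp-≈ p†g≈p†h ⟩
      (p † ∘ h) †   ≈⟨ †-∘-† p h ⟩
      h † ∘ p       ∎

  image-⟂⇔⟂ : ∀ {I A Y C} {i : Hom I Y} {h : Hom A Y} → IsImageOf i h →
              (n : Hom C Y) → (i ⟂ n) ⇔ (h ⟂ n)
  image-⟂⇔⟂ {i = i} {h} (_ , p , p-epi , h≈ip) n = mk⇔ to from
    where
    h†n≈p†i†n : h † ∘ n ≈ p † ∘ (i † ∘ n)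
    h†n≈p†i†n = begin
      h † ∘ n             ≈⟨ ∘-resp-≈ (†-resp-≈ h≈ip) ≈.refl ⟩
      (i ∘ p) † ∘ n       ≈⟨ ∘-resp-≈ †-homomorphism ≈.refl ⟩
      (p † ∘ i †) ∘ n     ≈⟨ assoc ⟩
      p † ∘ (i † ∘ n)     ∎
    to : i ⟂ n → h ⟂ n
    to i⟂n = begin
      h † ∘ n             ≈⟨ h†n≈p†i†n ⟩
      p † ∘ (i † ∘ n)     ≈⟨ ∘-resp-≈ ≈.refl i⟂n ⟩
      p † ∘ zero          ≈⟨ ∘-zero (p †) ⟩
      zero                ∎
    from : h ⟂ n → i ⟂ n
    from h⟂n = epi⇒†-mono p-epi (i † ∘ n) zero (begin
      p † ∘ (i † ∘ n)     ≈⟨ h†n≈p†i†n ⟨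
      h † ∘ n             ≈⟨ h⟂n ⟩
      zero                ≈⟨ ∘-zero (p †) ⟨
      p † ∘ zero          ∎)

theorem4 : ∀ {o ℓ e} (𝓗 : PreHilbertCategory o ℓ e) →
    let open PreHilbertCategory 𝓗 in
    ∀ {X Y} (f : Hom X Y) →
      ∀ {A} (m : Hom A X) → IsDaggerMono m →
      ∀ {B} (n : Hom B Y) → IsDaggerMono n →
      ∀ {I} (i : Hom I Y) → IsImageOf i (f ∘ m) →
      ∀ {J} (j : Hom J X) → IsImageOf j (f † ∘ n) →
      ∀ {K} (k : Hom K Y) → IsPerpOf k i →
      ∀ {L} (l : Hom L X) → IsPerpOf l j →
      (n ≤ₛ k) ⇔ (m ≤ₛ l)
theorem4 𝓗 f m _ n _ i i-image j j-image k k-perp l l-perp =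
  ⇔-trans (≤ₛ-perp⇔⟂ k-perp n)
  (⇔-trans (image-⟂⇔⟂ i-image n)
  (⇔-trans (∘-⟂⇔⟂-†∘ f m n)
  (⇔-trans (mk⇔ ⟂-sym ⟂-sym)
  (⇔-trans (⇔-sym (image-⟂⇔⟂ j-image m))
  (⇔-sym (≤ₛ-perp⇔⟂ l-perp m))))))
  where open Orthogonality (PreHilbertCategory.daggerCategory 𝓗) (PreHilbertCategory.zeroObject 𝓗)
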